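{- Let $H$ be an acyclic simple digraph, $k$ a positive integer, and $T$ a tournament that does not contain $k$ pairwise vertex-disjoint topological minor copies of $H$. Then there is a set $S$ of at most $2^{|V(H)|}k$ vertices of $T$ that is $H$-hitting, i.e., $T-S$ does not contain $H$ as a topological minor.
   Context: A tournament is a simple digraph in which every pair of distinct vertices is joined by exactly one arc. A topological minor copy of $H$ is a digraph $\widehat H$ with a mapping sending vertices of $H$ to distinct vertices and arcs $(u,v)$ of $H$ to directed paths between the images, these paths being internally vertex-disjoint, avoiding images of vertices as internal vertices, and covering all arcs and all non-image vertices of $\widehat H$ exactly once; a digraph contains $H$ as a topological minor if it has a subgraph that is a topological minor copy of $H$. $T-S$ denotes the subtournament induced on $V(T)\setminus S$. -}

module Defs where

open import Data.Nat using (ℕ)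
open import Data.Fin using (Fin)
open import Data.Bool using (Bool; true; false)
open import Data.List using (List; []; _∷_; _++_)
open import Data.List.Membership.Propositional using (_∈_)
open import Data.List.Relation.Unary.Unique.Propositional using (Unique)
open import Data.Product using (_×_; Σ; ∃)
open import Data.Sum using (_⊎_)
open import Data.Empty using (⊥)
open import Data.Unit using (⊤)
open import Relation.Binary.PropositionalEquality using (_≡_; _≢_)
open import Function.Definitions using (Injective)

record Digraph : Set where
  field
    size     : ℕ
    arc      : Fin size → Fin size → Bool
    loopless : ∀ v → arc v v ≡ false
open Digraph public

record Tournament : Set where
  field
    graph      : Digraph
    tournament : ∀ (u v : Fin (size graph)) → u ≢ v →
                 (arc graph u v ≡ true × arc graph v u ≡ false)
                 ⊎ (arc graph u v ≡ false × arc graph v u ≡ true)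
open Tournament public

-- Walk G a xs b : a → x₁ → … → xₙ → b is a directed walk in G
-- (xs = list of intermediate vertices).
Walk : (G : Digraph) → Fin (size G) → List (Fin (size G)) → Fin (size G) → Set
Walk G a []       b = arc G a b ≡ true
Walk G a (x ∷ xs) b = (arc G a x ≡ true) × Walk G x xs b

Acyclic : Digraph → Set
Acyclic G = ∀ v xs → Walk G v xs v → ⊥

-- A topological minor copy of H in G all of whose vertices satisfy
-- the predicate `Allowed` (used to restrict to the induced subgraph on
-- the allowed vertices, e.g. T - S).
record TopMinorCopy (G H : Digraph) (Allowed : Fin (size G) → Set) : Set where
  field
    φ        : Fin (size H) → Fin (size G)
    φ-inj    : Injective _≡_ _≡_ φ
    -- internal vertices of the path for the arc (u , v) (used only when
    -- (u , v) is an arc of H)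
    path     : Fin (size H) → Fin (size H) → List (Fin (size G))
    path-walk : ∀ u v → arc H u v ≡ true → Walk G (φ u) (path u v) (φ v)
    path-simple : ∀ u v → arc H u v ≡ true →
                  Unique (φ u ∷ path u v ++ φ v ∷ [])
    path-avoids-φ : ∀ u v → arc H u v ≡ true → ∀ w → φ w ∈ path u v → ⊥
    paths-disjoint : ∀ u v u' v' → arc H u v ≡ true → arc H u' v' ≡ true →
                     (u ≡ u' × v ≡ v' → ⊥) →
                     ∀ x → x ∈ path u v → x ∈ path u' v' → ⊥
    φ-allowed : ∀ w → Allowed (φ w)
    path-allowed : ∀ u v → arc H u v ≡ true → ∀ x → x ∈ path u v → Allowed x
open TopMinorCopy public

_∈V_ : ∀ {G H A} → Fin (size G) → TopMinorCopy G H A → Set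
_∈V_ {H = H} x C =
  (∃ λ w → φ C w ≡ x)
  ⊎ (Σ (Fin (size H)) λ u → Σ (Fin (size H)) λ v →
       (arc H u v ≡ true) × (x ∈ path C u v))

DisjointCopies : (G H : Digraph) → ℕ → Set
DisjointCopies G H k =
  Σ (Fin k → TopMinorCopy G H (λ _ → ⊤)) λ C →
    ∀ i j → i ≢ j → ∀ x → x ∈V C i → x ∈V C j → ⊥

-- If T has at most 2 ^ |V(H)| k vertices, S = V(T) works: a copy of H avoiding all of T forces
-- H to be empty, and then k disjoint copies exist trivially. Otherwise T even contains k
-- vertex-disjoint copies of H as subgraphs. An acyclic digraph on m vertices embeds into any
-- 2 ^ m vertices of a tournament: for one of them, x, at least 2 ^ (m - 1) of the others are
-- out-neighbours or at least 2 ^ (m - 1) are in-neighbours; embed H minus a source (resp. a sink)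
-- there and send that vertex to x. Cutting T into blocks of 2 ^ |V(H)| vertices gives the copies.
module Submission where

open import Defs
open import Data.Nat using (ℕ; zero; suc; _≤_; _<_; _+_; _*_; _∸_; _^_; z≤n; s≤s)
open import Data.Nat.Properties
  using (≤-reflexive; ≤-trans; ≤-pred; _≤?_; ≰⇒>; <⇒≤; <⇒≱; +-suc; +-cancelˡ-≤; +-monoˡ-≤; +-identityʳ; m∸n+n≡m; m^n>0; *-suc; n<1+n)
open import Data.Fin using (Fin; zero; suc; toℕ; _≟_)
open import Data.Fin.Properties using (pigeonhole)
open import Data.Fin.Subset using (Subset; _∉_; ∣_∣; ⊤)
open import Data.Fin.Subset.Properties using (∈⊤; ∣⊤∣≡n)
open import Data.Bool using (true)
import Data.Bool.Properties as Bool
open import Data.List using (List; []; _∷_; _++_; length; filter; take; drop; allFin)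
open import Data.List.Properties using (filter-notAll; length-tabulate; take++drop≡id)
open import Data.List.Membership.Propositional using (_∈_; find; lose)
open import Data.List.Membership.Propositional.Properties using (∈-filter⁺; ∈-filter⁻; ∈-allFin; ∈-++⁺ˡ; ∈-++⁺ʳ)
open import Data.List.Relation.Unary.Any as Any using (here; there)
open import Data.List.Relation.Unary.All as All using ([]; _∷_)
import Data.List.Relation.Unary.All.Properties as All
open import Data.List.Relation.Unary.Unique.Propositional using (Unique; []; _∷_)
open import Data.List.Relation.Unary.Unique.Propositional.Properties using (filter⁺; allFin⁺)
open import Data.Product using (Σ; ∃; ∃₂; _×_; _,_; proj₁; proj₂)
open import Data.Sum using (_⊎_; inj₁; inj₂)
open import Data.Empty using (⊥; ⊥-elim)
import Data.Unit
open import Function using (_∘_; flip)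
open import Relation.Nullary using (¬_; yes; no; ¬?; contradiction; decidable-stable)
open import Relation.Unary using (Decidable)
import Relation.Binary as B
open import Relation.Binary.PropositionalEquality using (_≡_; _≢_; refl; sym; trans; cong; subst)
open import Data.Vec.Functional using (updateAt)
open import Data.Vec.Functional.Properties using (updateAt-updates; updateAt-minimal)

Arc : (G : Digraph) → Fin (size G) → Fin (size G) → Set
Arc G u v = arc G u v ≡ true

arc? : (G : Digraph) → B.Decidable (Arc G)
arc? G u v = arc G u v Bool.≟ true

NoInfiniteDescent : {A : Set} → (A → A → Set) → Set
NoInfiniteDescent {A} R = (g : ℕ → A) → ¬ (∀ i → R (g (suc i)) (g i))

module _ (G : Digraph) where

  descent : (ℕ → Fin (size G)) → ℕ → List (Fin (size G))
  descent g zero    = []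
  descent g (suc d) = g (suc d) ∷ descent g d

  descent-walk : ∀ g → (∀ i → Arc G (g (suc i)) (g i)) →
                 ∀ d → Walk G (g (suc d)) (descent g d) (g 0)
  descent-walk g desc zero    = desc 0
  descent-walk g desc (suc d) = desc (suc d) , descent-walk g desc d

  ascent : (ℕ → Fin (size G)) → ℕ → List (Fin (size G))
  ascent g zero    = []
  ascent g (suc d) = g 1 ∷ ascent (g ∘ suc) d

  ascent-walk : ∀ g → (∀ i → Arc G (g i) (g (suc i))) →
                ∀ d → Walk G (g 0) (ascent g d) (g (suc d))
  ascent-walk g asc zero    = asc 0
  ascent-walk g asc (suc d) = asc 0 , ascent-walk (g ∘ suc) (asc ∘ suc) d

repeats : ∀ {n} (g : ℕ → Fin n) → ∃₂ λ a d → g (suc d + a) ≡ g a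
repeats {n} g with pigeonhole (n<1+n n) (g ∘ toℕ)
... | i , j , i<j , gi≡gj = toℕ i , toℕ j ∸ suc (toℕ i) , trans (cong g gap) (sym gi≡gj)
  where
    gap : suc (toℕ j ∸ suc (toℕ i)) + toℕ i ≡ toℕ j
    gap = trans (sym (+-suc _ (toℕ i))) (m∸n+n≡m i<j)

module _ {G : Digraph} (acyclic : Acyclic G) where

  -- A repetition g a = g (a + d + 1) in a chain closes a walk.
  acyclic⇒noDescent : NoInfiniteDescent (Arc G)
  acyclic⇒noDescent g desc with repeats g
  ... | a , d , loop = acyclic (g a) (descent G h d)
          (subst (λ v → Walk G v (descent G h d) (g a)) loop (descent-walk G h (desc ∘ (_+ a)) d))
    where h = λ i → g (i + a)

  acyclic⇒noAscent : NoInfiniteDescent (flip (Arc G))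
  acyclic⇒noAscent g asc with repeats g
  ... | a , d , loop = acyclic (g a) (ascent G h d)
          (subst (Walk G (g a) (ascent G h d)) loop (ascent-walk G h (asc ∘ (_+ a)) d))
    where h = λ i → g (i + a)

module _ {A : Set} {R : A → A → Set} (R? : B.Decidable R) (noDescent : NoInfiniteDescent R) where

  -- Without a minimal element every member of L has an R-predecessor in L, which iterates to an infinite descent.
  minimal : ∀ {L : List A} {a} → a ∈ L → ∃ λ m → m ∈ L × ∀ {u} → u ∈ L → ¬ R u m
  minimal {L} {a} a∈L with Any.any? (λ m → ¬? (Any.any? (λ u → R? u m) L)) L
  ... | yes ∃min with find ∃min
  ...   | m , m∈L , noPred = m , m∈L , λ u∈L r → noPred (lose u∈L r)
  minimal {L} {a} a∈L | no ¬∃min = ⊥-elim (noDescent (proj₁ ∘ chain) (proj₂ ∘ proj₂ ∘ predecessor ∘ proj₂ ∘ chain))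
    where
      predecessor : ∀ {v} → v ∈ L → ∃ λ u → u ∈ L × R u v
      predecessor v∈L = find (decidable-stable (Any.any? (λ u → R? u _) L) (¬∃min ∘ lose v∈L))
      chain : ℕ → ∃ (_∈ L)
      chain zero    = a , a∈L
      chain (suc i) = let u , u∈L , _ = predecessor (proj₂ (chain i)) in u , u∈L

remove : ∀ {n} → Fin n → List (Fin n) → List (Fin n)
remove s = filter (λ u → ¬? (u ≟ s))

∈-remove⁺ : ∀ {n} {s u : Fin n} {L} → u ∈ L → u ≢ s → u ∈ remove s L
∈-remove⁺ = ∈-filter⁺ (λ u → ¬? (u ≟ _))

length-remove : ∀ {n} {s : Fin n} {L} → s ∈ L → length (remove s L) < length L
length-remove {L = L} s∈L = filter-notAll (λ u → ¬? (u ≟ _)) L (lose s∈L λ s≢s → s≢s refl)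

module _ (G H : Digraph) where

  -- Embeds the subdigraph of H induced by L into X; `to` is arbitrary outside L.

  record Embedding (L : List (Fin (size H))) (X : List (Fin (size G))) : Set where
    field
      to           : Fin (size H) → Fin (size G)
      to-∈         : ∀ {u} → u ∈ L → to u ∈ X
      to-injective : ∀ {u v} → u ∈ L → v ∈ L → to u ≡ to v → u ≡ v
      to-arc       : ∀ {u v} → u ∈ L → v ∈ L → Arc H u v → Arc G (to u) (to v)

open Embedding

module _ {G H : Digraph} where

  Embedding-mono : ∀ {L X Y} → (∀ {x} → x ∈ X → x ∈ Y) → Embedding G H L X → Embedding G H L Y
  Embedding-mono X⊆Y E = record { to = to E ; to-∈ = X⊆Y ∘ to-∈ E
                                ; to-injective = to-injective E ; to-arc = to-arc E }

  extend : ∀ {L rest} s x → ¬ x ∈ rest → (E : Embedding G H (remove s L) rest) →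
           (∀ {v} → v ∈ L → v ≢ s → Arc H s v → Arc G x (to E v)) →
           (∀ {u} → u ∈ L → u ≢ s → Arc H u s → Arc G (to E u) x) →
           Embedding G H L (x ∷ rest)
  extend {L} {rest} s x x∉rest E out-arcs in-arcs = record
    { to = to′ ; to-∈ = into ; to-injective = injective ; to-arc = arcs }
    where
      to′ : Fin (size H) → Fin (size G)
      to′ = updateAt (to E) s λ _ → x

      view : ∀ u → (u ≡ s × to′ u ≡ x) ⊎ (u ≢ s × to′ u ≡ to E u)
      view u with u ≟ s
      ... | yes refl = inj₁ (refl , updateAt-updates s (to E))
      ... | no u≢s   = inj₂ (u≢s , updateAt-minimal u s (to E) u≢s)

      into-rest : ∀ {u} → u ∈ L → u ≢ s → to E u ∈ rest
      into-rest u∈L u≢s = to-∈ E (∈-remove⁺ u∈L u≢s)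

      into : ∀ {u} → u ∈ L → to′ u ∈ x ∷ rest
      into {u} u∈L with view u
      ... | inj₁ (_ , eq)   rewrite eq = here refl
      ... | inj₂ (u≢s , eq) rewrite eq = there (into-rest u∈L u≢s)

      x≢old : ∀ {u} → u ∈ L → u ≢ s → x ≢ to E u
      x≢old u∈L u≢s x≡ = x∉rest (subst (_∈ rest) (sym x≡) (into-rest u∈L u≢s))

      injective : ∀ {u v} → u ∈ L → v ∈ L → to′ u ≡ to′ v → u ≡ v
      injective {u} {v} u∈L v∈L eq with view u | view v
      ... | inj₁ (refl , _)  | inj₁ (refl , _)  = refl
      ... | inj₁ (_ , eu)    | inj₂ (v≢s , ev) = ⊥-elim (x≢old v∈L v≢s (trans (sym eu) (trans eq ev)))
      ... | inj₂ (u≢s , eu)  | inj₁ (_ , ev)    = ⊥-elim (x≢old u∈L u≢s (trans (sym ev) (trans (sym eq) eu)))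
      ... | inj₂ (u≢s , eu)  | inj₂ (v≢s , ev) =
        to-injective E (∈-remove⁺ u∈L u≢s) (∈-remove⁺ v∈L v≢s) (trans (sym eu) (trans eq ev))

      arcs : ∀ {u v} → u ∈ L → v ∈ L → Arc H u v → Arc G (to′ u) (to′ v)
      arcs {u} {v} u∈L v∈L a with view u | view v
      ... | inj₁ (refl , _)  | inj₁ (refl , _)  = contradiction (trans (sym a) (loopless H u)) λ ()
      ... | inj₁ (refl , eu) | inj₂ (v≢s , ev) rewrite eu | ev = out-arcs v∈L v≢s a
      ... | inj₂ (u≢s , eu)  | inj₁ (refl , ev) rewrite eu | ev = in-arcs u∈L u≢s a
      ... | inj₂ (u≢s , eu)  | inj₂ (v≢s , ev) rewrite eu | ev =
        to-arc E (∈-remove⁺ u∈L u≢s) (∈-remove⁺ v∈L v≢s) a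

length-filter+length-filter-∁ : ∀ {A : Set} {P : A → Set} (P? : Decidable P) xs →
  length (filter P? xs) + length (filter (λ y → ¬? (P? y)) xs) ≡ length xs
length-filter+length-filter-∁ P? [] = refl
length-filter+length-filter-∁ P? (y ∷ ys) with P? y
... | yes _ = cong suc (length-filter+length-filter-∁ P? ys)
... | no  _ = trans (+-suc _ _) (cong suc (length-filter+length-filter-∁ P? ys))

2^suc≤1+⇒halves : ∀ m a b → 2 ^ suc m ≤ suc (a + b) → 2 ^ m ≤ a ⊎ 2 ^ m ≤ b
2^suc≤1+⇒halves m a b le with 2 ^ m ≤? a
... | yes 2^m≤a = inj₁ 2^m≤a
... | no  2^m≰a = inj₂ (subst (_≤ b) (+-identityʳ (2 ^ m))
                   (+-cancelˡ-≤ (2 ^ m) _ _ (≤-trans le (+-monoˡ-≤ b (≰⇒> 2^m≰a)))))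

head∉tail : ∀ {A : Set} {x : A} {xs} → All.All (x ≢_) xs → ¬ x ∈ xs
head∉tail x≢xs x∈xs = All.lookup x≢xs x∈xs refl

module _ {A : Set} where

  Unique-++⁻ : ∀ (xs : List A) {ys} → Unique (xs ++ ys) → Unique xs × Unique ys × (∀ {v} → v ∈ xs → ¬ v ∈ ys)
  Unique-++⁻ []       uniq            = [] , uniq , λ ()
  Unique-++⁻ (x ∷ xs) (x≢xsys ∷ uniq) =
    let uxs , uys , xs#ys = Unique-++⁻ xs uniq
    in All.++⁻ˡ xs x≢xsys ∷ uxs , uys , λ where
         (here refl)  v∈ys → head∉tail (All.++⁻ʳ xs x≢xsys) v∈ys
         (there v∈xs) v∈ys → xs#ys v∈xs v∈ys

  take-drop-lengths : ∀ p {q} (xs : List A) → p + q ≤ length xs →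
                      p ≤ length (take p xs) × q ≤ length (drop p xs)
  take-drop-lengths zero    xs       le        = z≤n , le
  take-drop-lengths (suc p) (x ∷ xs) (s≤s le) = let p≤ , q≤ = take-drop-lengths p xs le in s≤s p≤ , q≤

2^m≰0 : ∀ m → ¬ 2 ^ m ≤ 0
2^m≰0 m = <⇒≱ (m^n>0 2 m)

tournament-converse : ∀ (T : Tournament) {x y} → ¬ Arc (graph T) x y → x ≢ y → Arc (graph T) y x
tournament-converse T {x} {y} ¬xy x≢y with tournament T x y x≢y
... | inj₁ (xy , _) = contradiction xy ¬xy
... | inj₂ (_ , yx) = yx

DisjointImages : ∀ {G H L X k} → (Fin k → Embedding G H L X) → Set
DisjointImages E = ∀ i j → i ≢ j → ∀ u v → to (E i) u ≢ to (E j) v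

module _ (T : Tournament) {H : Digraph} (acyclic : Acyclic H) where

  private
    G = graph T
    n = size H

  -- Some vertex x has 2 ^ m out- or in-neighbours; there we embed H without a source, resp. sink, mapped to x.
  embed : ∀ m L → length L ≤ m → (X : List (Fin (size G))) → Unique X → 2 ^ m ≤ length X → Embedding G H L X
  embed m       []        _         []         _               big = ⊥-elim (2^m≰0 m big)
  embed m       []        _         (x ∷ _)    _               _   =
    record { to = λ _ → x ; to-∈ = λ () ; to-injective = λ () ; to-arc = λ () }
  embed zero    (_ ∷ _)   ()        _          _               _
  embed (suc m) (_ ∷ _)   _         []         _               big = ⊥-elim (2^m≰0 (suc m) big)
  embed (suc m) L@(_ ∷ _) (s≤s len) (x ∷ rest) (x≢rest ∷ uniq) big
    with 2^suc≤1+⇒halves m _ _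
           (subst (λ k → 2 ^ suc m ≤ suc k) (sym (length-filter+length-filter-∁ (arc? G x) rest)) big)
  ... | inj₁ manyOut =
    let s , s∈L , noIn = minimal (arc? H) (acyclic⇒noDescent acyclic) (here refl)
        E = embed m (remove s L) (≤-pred (≤-trans (length-remove s∈L) (s≤s len)))
                  (filter (arc? G x) rest) (filter⁺ _ uniq) manyOut
    in extend s x (head∉tail x≢rest) (Embedding-mono (proj₁ ∘ ∈-filter⁻ _ {xs = rest}) E)
         (λ v∈L v≢s _ → proj₂ (∈-filter⁻ (arc? G x) {xs = rest} (to-∈ E (∈-remove⁺ v∈L v≢s))))
         (λ u∈L _ a → contradiction a (noIn u∈L))
  ... | inj₂ manyIn =
    let s , s∈L , noOut = minimal (flip (arc? H)) (acyclic⇒noAscent acyclic) (here refl)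
        E = embed m (remove s L) (≤-pred (≤-trans (length-remove s∈L) (s≤s len)))
                  (filter (¬? ∘ arc? G x) rest) (filter⁺ _ uniq) manyIn
    in extend s x (head∉tail x≢rest) (Embedding-mono (proj₁ ∘ ∈-filter⁻ _ {xs = rest}) E)
         (λ v∈L _ a → contradiction a (noOut v∈L))
         (λ u∈L u≢s _ →
            let y∈rest , ¬xy = ∈-filter⁻ (¬? ∘ arc? G x) {xs = rest} (to-∈ E (∈-remove⁺ u∈L u≢s))
            in tournament-converse T ¬xy (All.lookup x≢rest y∈rest))


  length-allFin : length (allFin n) ≤ n
  length-allFin = ≤-reflexive (length-tabulate (λ u → u))

  -- Cut X into a block of 2 ^ n vertices, which receives one copy, and the rest.
  packing : ∀ k (X : List (Fin (size G))) → Unique X → 2 ^ n * k ≤ length X →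
            Σ (Fin k → Embedding G H (allFin n) X) DisjointImages
  packing zero    X _    _   = (λ ()) , λ ()
  packing (suc k) X uniq big
    with uY , uZ , Y#Z ← Unique-++⁻ (take (2 ^ n) X) (subst Unique (sym (take++drop≡id (2 ^ n) X)) uniq)
       | bigY , bigZ ← take-drop-lengths (2 ^ n) X (subst (_≤ length X) (*-suc (2 ^ n) k) big)
    with rest , rest-disjoint ← packing k (drop (2 ^ n) X) uZ bigZ
    = E , disjoint
    where
      Y = take (2 ^ n) X
      Z = drop (2 ^ n) X
      first = embed n (allFin n) length-allFin Y uY bigY

      Y++Z≡X : Y ++ Z ≡ X
      Y++Z≡X = take++drop≡id (2 ^ n) X

      E : Fin (suc k) → Embedding G H (allFin n) X
      E zero    = Embedding-mono (λ y∈Y → subst (_ ∈_) Y++Z≡X (∈-++⁺ˡ y∈Y)) first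
      E (suc i) = Embedding-mono (λ z∈Z → subst (_ ∈_) Y++Z≡X (∈-++⁺ʳ Y z∈Z)) (rest i)

      disjoint : DisjointImages E
      disjoint zero    zero    0≢0 _ _ _  = 0≢0 refl
      disjoint zero    (suc j) _   u v eq =
        Y#Z (to-∈ first (∈-allFin u)) (subst (_∈ Z) (sym eq) (to-∈ (rest j) (∈-allFin v)))
      disjoint (suc i) zero    _   u v eq =
        Y#Z (to-∈ first (∈-allFin v)) (subst (_∈ Z) eq (to-∈ (rest i) (∈-allFin u)))
      disjoint (suc i) (suc j) i≢j u v eq = rest-disjoint i j (i≢j ∘ cong suc) u v eq

module _ {G H : Digraph} where

  toCopy : ∀ {X} → Embedding G H (allFin (size H)) X → TopMinorCopy G H (λ _ → Data.Unit.⊤)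
  toCopy E = record
    { φ              = to E
    ; φ-inj          = to-injective E (∈-allFin _) (∈-allFin _)
    ; path           = λ _ _ → []
    ; path-walk      = λ u v → to-arc E (∈-allFin u) (∈-allFin v)
    ; path-simple    = λ u v a → (to-injective-≢ u v a ∷ []) ∷ [] ∷ []
    ; path-avoids-φ  = λ _ _ _ _ ()
    ; paths-disjoint = λ _ _ _ _ _ _ _ _ ()
    ; φ-allowed      = λ _ → Data.Unit.tt
    ; path-allowed   = λ _ _ _ _ ()
    }
    where
      to-injective-≢ : ∀ u v → Arc H u v → to E u ≢ to E v
      to-injective-≢ u v a eq with to-injective E (∈-allFin u) (∈-allFin v) eq
      ... | refl = contradiction (trans (sym a) (loopless H u)) λ ()

  ∈V-toCopy : ∀ {X} (E : Embedding G H (allFin (size H)) X) {x} → x ∈V toCopy E → ∃ λ w → to E w ≡ x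
  ∈V-toCopy E (inj₁ w,eq)            = w,eq
  ∈V-toCopy E (inj₂ (_ , _ , _ , ()))

  disjointCopies : ∀ {k X} (E : Fin k → Embedding G H (allFin (size H)) X) → DisjointImages E →
                   DisjointCopies G H k
  disjointCopies E disjoint = toCopy ∘ E , λ i j i≢j x x∈i x∈j →
    let u , eu = ∈V-toCopy (E i) x∈i
        v , ev = ∈V-toCopy (E j) x∈j
    in disjoint i j i≢j u v (trans eu (sym ev))

  vertexless⇒disjointCopies : ∀ k → ¬ Fin (size H) → DisjointCopies G H k
  vertexless⇒disjointCopies k noVertex = disjointCopies {X = []} (λ _ → vacuous) λ _ _ _ u → ⊥-elim (noVertex u)
    where
      vacuous : Embedding G H (allFin (size H)) []
      vacuous = record { to = ⊥-elim ∘ noVertex ; to-∈ = λ {u} _ → ⊥-elim (noVertex u)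
                       ; to-injective = λ {u} _ _ _ → ⊥-elim (noVertex u)
                       ; to-arc = λ {u} _ _ _ → ⊥-elim (noVertex u) }

tournament-disjointCopies : ∀ (T : Tournament) {H} → Acyclic H →
                            ∀ k → 2 ^ size H * k ≤ size (graph T) → DisjointCopies (graph T) H k
tournament-disjointCopies T {H} acyclic k big =
  let E , disjoint = packing T acyclic k (allFin _) (allFin⁺ _)
                       (subst (2 ^ size H * k ≤_) (sym (length-tabulate (λ x → x))) big)
  in disjointCopies E disjoint

-- The hypothesis 1 ≤ k is unused: for k = 0 the hypothesis ¬ DisjointCopies is already absurd.
corollary20 : (H : Digraph) → Acyclic H → (k : ℕ) → 1 ≤ k →
    (T : Tournament) → ¬ DisjointCopies (graph T) H k →
    Σ (Subset (size (graph T))) λ S →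
      (∣ S ∣ ≤ 2 ^ size H * k)
      × ¬ TopMinorCopy (graph T) H (λ x → x ∉ S)
corollary20 H acyclic k _ T noCopies with size (graph T) ≤? 2 ^ size H * k
... | yes small = ⊤ , subst (_≤ 2 ^ size H * k) (sym (∣⊤∣≡n _)) small ,
                  λ C → noCopies (vertexless⇒disjointCopies k λ w → φ-allowed C w ∈⊤)
... | no large  = ⊥-elim (noCopies (tournament-disjointCopies T acyclic k (<⇒≤ (≰⇒> large))))
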